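{- Let $m$ points on a circle be numbered $1,\ldots,m$ in clockwise order, and let $T$ be a noncrossing tree on this set of points (a tree whose edges, drawn as chords, do not cross). Then the edges of $T$ can be numbered in such a way that for each point $u$, the numbers of the edges incident to $u$ are increasing in clockwise order around $u$ (that is, if $v_1,\ldots,v_k$ are the neighbours of $u$ in $T$ listed in the order met when travelling clockwise around the circle starting just after $u$, then the numbers of the edges $uv_1,\ldots,uv_k$ are increasing). -}

module Defs where

open import Data.Nat using (ℕ; _≤_; _<_)
open import Data.Fin using (Fin) renaming (_<_ to _<ᶠ_)
open import Data.Product using (_×_; _,_; Σ; ∃)
open import Data.Sum using (_⊎_)
open import Data.Unit using (⊤)
open import Data.List using (List; []; _∷_; _++_; [_]; length)
open import Data.List.Membership.Propositional using (_∈_)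
open import Data.List.Relation.Unary.Unique.Propositional using (Unique)
open import Relation.Nullary using (¬_)
open import Relation.Binary.PropositionalEquality using (_≡_)

-- Points on the circle: Fin m, numbered 0,…,m-1 in clockwise order
-- (the paper's 1,…,m shifted by one).
-- A graph on these points is given by a list of edges (a , b), each stored
-- once with a < b (chords, unordered pairs).

Edges : ℕ → Set
Edges m = List (Fin m × Fin m)

Adj : ∀ {m} → Edges m → Fin m → Fin m → Set
Adj E u v = ((u , v) ∈ E) ⊎ ((v , u) ∈ E)

SimpleEdges : ∀ {m} → Edges m → Set
SimpleEdges E = (∀ a b → (a , b) ∈ E → a <ᶠ b) × Unique E

data Reach {m} (E : Edges m) : Fin m → Fin m → Set where
  here  : ∀ {u} → Reach E u u
  step  : ∀ {u w v} → Adj E u w → Reach E w v → Reach E u v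

Connected : ∀ {m} → Edges m → Set
Connected {m} E = (u v : Fin m) → Reach E u v

ChainFrom : ∀ {m} → Edges m → Fin m → List (Fin m) → Set
ChainFrom E v []       = ⊤
ChainFrom E v (w ∷ ws) = Adj E v w × ChainFrom E w ws

HasCycle : ∀ {m} → Edges m → Set
HasCycle {m} E =
  Σ (Fin m) λ v → Σ (List (Fin m)) λ ws →
    (2 ≤ length ws) × Unique (v ∷ ws) × ChainFrom E v (ws ++ [ v ])

IsTree : ∀ {m} → Edges m → Set
IsTree E = SimpleEdges E × Connected E × ¬ HasCycle E

Cross : ∀ {m} → Fin m × Fin m → Fin m × Fin m → Set
Cross (a , b) (c , d) = (a <ᶠ c) × (c <ᶠ b) × (b <ᶠ d)

Noncrossing : ∀ {m} → Edges m → Set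
Noncrossing E = ∀ e f → e ∈ E → f ∈ E → ¬ Cross e f

-- Travelling clockwise around the circle starting just after u,
-- the point v is met strictly before the point w.
CwBefore : ∀ {m} → Fin m → Fin m → Fin m → Set
CwBefore u v w =
  ((u <ᶠ v) × (v <ᶠ w)) ⊎ ((v <ᶠ w) × (w <ᶠ u)) ⊎ ((w <ᶠ u) × (u <ᶠ v))

GoodNumbering : ∀ {m} → Edges m → (Fin m → Fin m → ℕ) → Set
GoodNumbering {m} E ℓ =
  (∀ u v → ℓ u v ≡ ℓ v u) ×
  (∀ a b c d → (a , b) ∈ E → (c , d) ∈ E → ℓ a b ≡ ℓ c d → (a , b) ≡ (c , d)) ×
  (∀ u v w → Adj E u v → Adj E u w → CwBefore u v w → ℓ u v < ℓ u w)

{-# OPTIONS --safe #-}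
-- Delete a leaf b with its edge ab and number the rest
-- by induction. Replacing every number k by 2 + 2k keeps all local orders and
-- frees the odd numbers; ab gets the odd number 1 + 2M, where M exceeds the
-- numbers of the edges at a met before b clockwise from a. By the local order
-- at a those are below the numbers of the edges met after b, so M can be
-- chosen below the latter as well. Only a and b see the edge ab, and at b it
-- is the only edge.
module Submission where

open import Defs
open import Data.Nat using (ℕ; zero; suc; _+_; _*_; _≤_; _<_; z≤n; s≤s; _≤?_)
open import Data.Nat.Properties
  using (1+n≰n; n≤1+n; ≰⇒>; +-suc; ≤-trans; m≤m+n; suc-injective; +-monoʳ-<; *-suc;
         *-monoʳ-≤; *-monoʳ-<; *-cancelˡ-≡; even≢odd; module ≤-Reasoning)
open import Data.Nat.Induction using (<-wellFounded)
open import Induction.WellFounded using (Acc; acc)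
open import Data.Fin using (Fin) renaming (_<_ to _<ᶠ_; _<?_ to _<ᶠ?_)
open import Data.Fin.Properties using (_≟_; pigeonhole)
  renaming (<-irrefl to <ᶠ-irrefl; <-asym to <ᶠ-asym; <-trans to <ᶠ-trans; <⇒≢ to <ᶠ⇒≢)
open import Data.Product using (_×_; _,_; ∃; ∃₂; proj₁; proj₂; swap)
open import Data.Product.Properties using (≡-dec)
open import Data.Sum as Sum using (_⊎_; inj₁; inj₂)
open import Data.Unit using (tt)
open import Data.Empty using (⊥-elim)
open import Data.List using (List; []; _∷_; _++_; [_]; length; lookup; filter; map; allFin)
open import Data.List.Properties using (++-assoc; filter-notAll)
open import Data.List.Extrema.Nat using (max; xs≤max; max≤v⁺)
open import Data.List.Membership.Propositional using (_∈_; lose; find)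
open import Data.List.Membership.Propositional.Properties
  using (∈-∃++; ∈-lookup; ∈-filter⁺; ∈-filter⁻; ∈-allFin)
import Data.List.Membership.DecPropositional as DecMembership
open import Data.List.Relation.Binary.Subset.Propositional using (_⊆_)
open import Data.List.Relation.Unary.Any using (Any; here;  any?)
open import Data.List.Relation.Unary.All as All using (All; []; _∷_)
open import Data.List.Relation.Unary.All.Properties using (¬Any⇒All¬; ++⁻ˡ; map⁺; map⁻)
open import Data.List.Relation.Unary.AllPairs using ([]; _∷_)
open import Data.List.Relation.Unary.Unique.Propositional using (Unique)
open import Function using (_∘_; id)
open import Relation.Nullary using (¬_; Dec; yes; no; ¬?; contradiction)
open import Relation.Nullary.Decidable using (_×-dec_; _⊎-dec_; decidable-stable)
open import Relation.Unary using (Decidable)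
open import Relation.Binary.PropositionalEquality using (_≡_; _≢_; refl; sym; trans; cong; subst)

2+2*-injective : ∀ {x y} → 2 + 2 * x ≡ 2 + 2 * y → x ≡ y
2+2*-injective eq = *-cancelˡ-≡ _ _ 2 (suc-injective (suc-injective eq))

2+2*≢1+2* : ∀ x y → 2 + 2 * x ≢ 1 + 2 * y
2+2*≢1+2* x y eq = even≢odd y x (sym (suc-injective eq))

2+2*<1+2* : ∀ {x y} → x < y → 2 + 2 * x < 1 + 2 * y
2+2*<1+2* {x} {y} x<y = s≤s (subst (_≤ 2 * y) (*-suc 2 x) (*-monoʳ-≤ 2 x<y))

1+2*<2+2* : ∀ {x y} → x ≤ y → 1 + 2 * x < 2 + 2 * y
1+2*<2+2* x≤y = s≤s (s≤s (*-monoʳ-≤ 2 x≤y))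

lookup-Unique : ∀ {A : Set} {xs : List A} → Unique xs → ∀ {i j} → i <ᶠ j → lookup xs i ≢ lookup xs j
lookup-Unique (x∉xs ∷ _) {Fin.zero} {Fin.suc j} _          = All.lookup x∉xs (∈-lookup j)
lookup-Unique (_ ∷ xs!) {Fin.suc i} {Fin.suc j} (s≤s i<j) = lookup-Unique xs! i<j

Unique-++⁻ˡ : ∀ {A : Set} (xs : List A) {ys} → Unique (xs ++ ys) → Unique xs
Unique-++⁻ˡ []       _            = []
Unique-++⁻ˡ (x ∷ xs) (x∉xs ∷ xs!) = ++⁻ˡ xs x∉xs ∷ Unique-++⁻ˡ xs xs!

length-∷ʳ-positive : ∀ {A : Set} (xs : List A) (w : A) → 1 ≤ length (xs ++ [ w ])
length-∷ʳ-positive []      _ = s≤s z≤n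
length-∷ʳ-positive (_ ∷ _) _ = s≤s z≤n

module _ {m : ℕ} where

  OrderedEdges : Edges m → Set
  OrderedEdges E = ∀ a b → (a , b) ∈ E → a <ᶠ b

  CwBefore-irrefl : ∀ {u v : Fin m} → ¬ CwBefore u v v
  CwBefore-irrefl (inj₁ (_ , v<v))          = <ᶠ-irrefl refl v<v
  CwBefore-irrefl (inj₂ (inj₁ (v<v , _)))   = <ᶠ-irrefl refl v<v
  CwBefore-irrefl (inj₂ (inj₂ (v<u , u<v))) = <ᶠ-asym v<u u<v

  CwBefore-trans : ∀ {u v w x : Fin m} → CwBefore u v w → CwBefore u w x → CwBefore u v x
  CwBefore-trans (inj₁ (u<v , v<w)) (inj₁ (_ , w<x))           = inj₁ (u<v , <ᶠ-trans v<w w<x)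
  CwBefore-trans (inj₁ (u<v , v<w)) (inj₂ (inj₁ (w<x , x<u)))  =
    ⊥-elim (<ᶠ-asym (<ᶠ-trans u<v v<w) (<ᶠ-trans w<x x<u))
  CwBefore-trans (inj₁ (u<v , _))   (inj₂ (inj₂ (x<u , _)))    = inj₂ (inj₂ (x<u , u<v))
  CwBefore-trans (inj₂ (inj₁ (_ , w<u))) (inj₁ (u<w , _))      = ⊥-elim (<ᶠ-asym u<w w<u)
  CwBefore-trans (inj₂ (inj₁ (v<w , _))) (inj₂ (inj₁ (w<x , x<u))) = inj₂ (inj₁ (<ᶠ-trans v<w w<x , x<u))
  CwBefore-trans (inj₂ (inj₁ (_ , w<u))) (inj₂ (inj₂ (_ , u<w))) = ⊥-elim (<ᶠ-asym u<w w<u)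
  CwBefore-trans (inj₂ (inj₂ (w<u , _))) (inj₁ (u<w , _))      = ⊥-elim (<ᶠ-asym u<w w<u)
  CwBefore-trans (inj₂ (inj₂ (_ , u<v))) (inj₂ (inj₁ (_ , x<u))) = inj₂ (inj₂ (x<u , u<v))
  CwBefore-trans (inj₂ (inj₂ (w<u , _))) (inj₂ (inj₂ (_ , u<w))) = ⊥-elim (<ᶠ-asym u<w w<u)

  cwBefore? : ∀ (u v w : Fin m) → Dec (CwBefore u v w)
  cwBefore? u v w =
    ((u <ᶠ? v) ×-dec (v <ᶠ? w)) ⊎-dec ((v <ᶠ? w) ×-dec (w <ᶠ? u)) ⊎-dec ((w <ᶠ? u) ×-dec (u <ᶠ? v))

  adj? : ∀ (E : Edges m) u → Decidable (Adj E u)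
  adj? E u v = (u , v) ∈? E ⊎-dec (v , u) ∈? E
    where open DecMembership (≡-dec _≟_ _≟_) using (_∈?_)

  Adj-sym : ∀ {E : Edges m} {u v} → Adj E u v → Adj E v u
  Adj-sym = Sum.swap

  Adj-mono : ∀ {E F : Edges m} → E ⊆ F → ∀ {u v} → Adj E u v → Adj F u v
  Adj-mono E⊆F = Sum.map E⊆F E⊆F

  Adj-irrefl : ∀ {E : Edges m} → OrderedEdges E → ∀ {u} → ¬ Adj E u u
  Adj-irrefl ordered (inj₁ uu∈E) = <ᶠ-irrefl refl (ordered _ _ uu∈E)
  Adj-irrefl ordered (inj₂ uu∈E) = <ᶠ-irrefl refl (ordered _ _ uu∈E)

  ChainFrom-mono : ∀ {E F : Edges m} → E ⊆ F → ∀ v ws → ChainFrom E v ws → ChainFrom F v ws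
  ChainFrom-mono E⊆F v []       _          = tt
  ChainFrom-mono E⊆F v (w ∷ ws) (v~w , ch) = Adj-mono E⊆F v~w , ChainFrom-mono E⊆F w ws ch

  ChainFrom-cut : ∀ {E : Edges m} v xs {w ys u} →
                  ChainFrom E v (xs ++ w ∷ ys) → Adj E w u → ChainFrom E v ((xs ++ [ w ]) ++ [ u ])
  ChainFrom-cut v []       (v~w , _)  w~u = v~w , w~u , tt
  ChainFrom-cut v (x ∷ xs) (v~x , ch) w~u = v~x , ChainFrom-cut x xs ch w~u

  HasCycle-mono : ∀ {E F : Edges m} → E ⊆ F → HasCycle E → HasCycle F
  HasCycle-mono E⊆F (v , ws , long , unique , ch) = v , ws , long , unique , ChainFrom-mono E⊆F v _ ch

  length-Unique≤ : ∀ {xs : List (Fin m)} → Unique xs → length xs ≤ m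
  length-Unique≤ {xs} xs! with length xs ≤? m
  ... | yes len≤m = len≤m
  ... | no len≰m with i , j , i<j , eq ← pigeonhole (≰⇒> len≰m) (lookup xs) =
    contradiction eq (lookup-Unique xs! i<j)

  LeavesAvoiding : Fin m → Fin m → Fin m × Fin m → Set
  LeavesAvoiding v p (c , d) = (c ≡ v × d ≢ p) ⊎ (d ≡ v × c ≢ p)

  neighbourOtherThan? : ∀ (E : Edges m) v p →
                        (∃ λ w → Adj E v w × w ≢ p) ⊎ (∀ w → Adj E v w → w ≡ p)
  neighbourOtherThan? E v p with any? leaves? E
    where
    leaves? : Decidable (LeavesAvoiding v p)
    leaves? (c , d) = ((c ≟ v) ×-dec ¬? (d ≟ p)) ⊎-dec ((d ≟ v) ×-dec ¬? (c ≟ p))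
  ... | yes some with (c , d) , cd∈E , leaving ← find some = inj₁ (neighbour leaving)
    where
    neighbour : LeavesAvoiding v p (c , d) → ∃ λ w → Adj E v w × w ≢ p
    neighbour (inj₁ (refl , d≢p)) = d , inj₁ cd∈E , d≢p
    neighbour (inj₂ (refl , c≢p)) = c , inj₂ cd∈E , c≢p
  ... | no none = inj₂ λ w v~w → decidable-stable (w ≟ p) (none ∘ leavingEdge v~w)
    where
    leavingEdge : ∀ {w} → Adj E v w → w ≢ p → Any (LeavesAvoiding v p) E
    leavingEdge (inj₁ vw∈E) w≢p = lose vw∈E (inj₁ (refl , w≢p))
    leavingEdge (inj₂ wv∈E) w≢p = lose wv∈E (inj₂ (refl , w≢p))

  PendantEdge : Edges m → Set
  PendantEdge E = ∃₂ λ a b → Adj E a b × (∀ w → Adj E b w → w ≡ a)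

  module _ {E : Edges m} (ordered : OrderedEdges E) (acyclic : ¬ HasCycle E) where

    -- cur ∷ p ∷ rs is a simple path read backwards, extended at cur away
    -- from p; it can neither close up nor outgrow Fin m, so it ends at a leaf.
    extendPathToLeaf : ∀ n cur p rs → Unique (cur ∷ p ∷ rs) → ChainFrom E cur (p ∷ rs) →
                       m ≤ n + length rs → PendantEdge E
    extendPathToLeaf zero cur p rs path! _ m≤len =
      contradiction (≤-trans (≤-trans (n≤1+n _) (length-Unique≤ path!)) m≤len) 1+n≰n
    extendPathToLeaf (suc n) cur p rs path! (cur~p , ch) m≤n+len
      with neighbourOtherThan? E cur p
    ... | inj₂ onlyP = p , cur , Adj-sym cur~p , onlyP
    ... | inj₁ (w , cur~w , w≢p) with DecMembership._∈?_ _≟_ w rs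
    ...   | yes w∈rs with xs , zs , refl ← ∈-∃++ w∈rs =
      ⊥-elim (acyclic (cur , p ∷ xs ++ [ w ] , s≤s (length-∷ʳ-positive xs w) , cycle! ,
                       ChainFrom-cut cur (p ∷ xs) (cur~p , ch) (Adj-sym cur~w)))
      where
      cycle! : Unique (cur ∷ p ∷ xs ++ [ w ])
      cycle! = Unique-++⁻ˡ (cur ∷ p ∷ xs ++ [ w ])
                 (subst Unique (sym (++-assoc (cur ∷ p ∷ xs) [ w ] zs)) path!)
    ...   | no w∉rs =
      extendPathToLeaf n w cur (p ∷ rs) (w∉path ∷ path!) (Adj-sym cur~w , cur~p , ch)
                       (subst (m ≤_) (sym (+-suc n (length rs))) m≤n+len)
      where
      w∉path : All (w ≢_) (cur ∷ p ∷ rs)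
      w∉path = (λ w≡cur → Adj-irrefl ordered (subst (Adj E cur) w≡cur cur~w))
               ∷ w≢p ∷ ¬Any⇒All¬ rs w∉rs

    acyclic⇒pendantEdge : ∀ {a b} → (a , b) ∈ E → PendantEdge E
    acyclic⇒pendantEdge {a} {b} ab∈E =
      extendPathToLeaf m b a [] (((<ᶠ⇒≢ (ordered a b ab∈E) ∘ sym) ∷ []) ∷ [] ∷ [])
                       (inj₂ ab∈E , tt) (m≤m+n m 0)

  Avoids : Fin m → Fin m × Fin m → Set
  Avoids b (c , d) = c ≢ b × d ≢ b

  avoids? : ∀ b → Decidable (Avoids b)
  avoids? b (c , d) = ¬? (c ≟ b) ×-dec ¬? (d ≟ b)

  removeVertex : Fin m → Edges m → Edges m
  removeVertex b = filter (avoids? b)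

  removeVertex-⊆ : ∀ b (E : Edges m) → removeVertex b E ⊆ E
  removeVertex-⊆ b E = proj₁ ∘ ∈-filter⁻ (avoids? b) {xs = E}

  Adj-removeVertex : ∀ {b} {E : Edges m} {u v} → Adj (removeVertex b E) u v → u ≢ b × v ≢ b
  Adj-removeVertex {b} {E} (inj₁ uv∈E-b) = proj₂ (∈-filter⁻ (avoids? b) {xs = E} uv∈E-b)
  Adj-removeVertex {b} {E} (inj₂ vu∈E-b) = swap (proj₂ (∈-filter⁻ (avoids? b) {xs = E} vu∈E-b))

  length-removeVertex< : ∀ {E : Edges m} {a b} → Adj E a b → length (removeVertex b E) < length E
  length-removeVertex< {E} {b = b} (inj₁ ab∈E) =
    filter-notAll (avoids? b) E (lose ab∈E λ (_ , b≢b) → b≢b refl)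
  length-removeVertex< {E} {b = b} (inj₂ ba∈E) =
    filter-notAll (avoids? b) E (lose ba∈E λ (b≢b , _) → b≢b refl)

  GoodNumbering-cut : ∀ {E : Edges m} {ℓ} → GoodNumbering E ℓ → ∀ a b → ∃ λ M →
                      (∀ w → Adj E a w → CwBefore a w b → ℓ a w < M) ×
                      (∀ w → Adj E a w → CwBefore a b w → M ≤ ℓ a w)
  GoodNumbering-cut {E} {ℓ} (_ , _ , increasing) a b = M , below , above
    where
    before? : Decidable (λ w → Adj E a w × CwBefore a w b)
    before? w = adj? E a w ×-dec cwBefore? a w b

    neighboursBefore : List (Fin m)
    neighboursBefore = filter before? (allFin m)

    M : ℕ
    M = max 0 (map (suc ∘ ℓ a) neighboursBefore)

    below : ∀ w → Adj E a w → CwBefore a w b → ℓ a w < M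
    below w a~w w<b = All.lookup (map⁻ {xs = neighboursBefore} (xs≤max 0 _))
                                 (∈-filter⁺ before? (∈-allFin w) (a~w , w<b))

    above : ∀ w → Adj E a w → CwBefore a b w → M ≤ ℓ a w
    above w a~w b<w = max≤v⁺ z≤n (map⁺ (All.tabulate λ v∈ →
      let a~v , v<b = proj₂ (∈-filter⁻ before? {xs = allFin m} v∈)
      in  increasing a _ w a~v a~w (CwBefore-trans v<b b<w)))

  module PendantEdgeExtension
    {E : Edges m} (ordered : OrderedEdges E) {a b : Fin m}
    (a~b : Adj E a b) (leaf : ∀ w → Adj E b w → w ≡ a)
    {ℓ : Fin m → Fin m → ℕ} (good : GoodNumbering (removeVertex b E) ℓ) where

    rest : Edges m
    rest = removeVertex b E

    ℓ-sym : ∀ u v → ℓ u v ≡ ℓ v u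
    ℓ-sym = proj₁ good

    ℓ-injective : ∀ c d c′ d′ → (c , d) ∈ rest → (c′ , d′) ∈ rest → ℓ c d ≡ ℓ c′ d′ → (c , d) ≡ (c′ , d′)
    ℓ-injective = proj₁ (proj₂ good)

    ℓ-increasing : ∀ u v w → Adj rest u v → Adj rest u w → CwBefore u v w → ℓ u v < ℓ u w
    ℓ-increasing = proj₂ (proj₂ good)

    M : ℕ
    M = proj₁ (GoodNumbering-cut good a b)

    before<M : ∀ w → Adj rest a w → CwBefore a w b → ℓ a w < M
    before<M = proj₁ (proj₂ (GoodNumbering-cut good a b))

    M≤after : ∀ w → Adj rest a w → CwBefore a b w → M ≤ ℓ a w
    M≤after = proj₂ (proj₂ (GoodNumbering-cut good a b))

    ℓ′ : Fin m → Fin m → ℕ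
    ℓ′ u v with u ≟ b | v ≟ b
    ... | no _ | no _ = 2 + 2 * ℓ u v
    ... | _    | _    = 1 + 2 * M

    IsNewEdge : Fin m → Fin m → Set
    IsNewEdge u v = (u ≡ a × v ≡ b) ⊎ (u ≡ b × v ≡ a)

    a≢b : a ≢ b
    a≢b refl = Adj-irrefl ordered a~b

    IsNewEdge-sym : ∀ {u v} → IsNewEdge u v → IsNewEdge v u
    IsNewEdge-sym (inj₁ (u≡a , v≡b)) = inj₂ (v≡b , u≡a)
    IsNewEdge-sym (inj₂ (u≡b , v≡a)) = inj₁ (v≡a , u≡b)

    IsNewEdge-functional : ∀ {u v w} → IsNewEdge u v → IsNewEdge u w → v ≡ w
    IsNewEdge-functional (inj₁ (refl , refl)) (inj₁ (_ , refl))   = refl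
    IsNewEdge-functional (inj₂ (refl , refl)) (inj₂ (_ , refl))   = refl
    IsNewEdge-functional (inj₁ (refl , _))    (inj₂ (a≡b , _))    = contradiction a≡b a≢b
    IsNewEdge-functional (inj₂ (refl , _))    (inj₁ (b≡a , _))    = contradiction (sym b≡a) a≢b

    IsNewEdge-avoiding : ∀ {u v} → u ≢ b → IsNewEdge u v → u ≡ a × v ≡ b
    IsNewEdge-avoiding _   (inj₁ new)      = new
    IsNewEdge-avoiding u≢b (inj₂ (u≡b , _)) = contradiction u≡b u≢b

    ∈-split : ∀ {c d} → (c , d) ∈ E → (c , d) ∈ rest ⊎ IsNewEdge c d
    ∈-split {c} {d} cd∈E with c ≟ b | d ≟ b
    ... | yes refl | _        = inj₂ (inj₂ (refl , leaf d (inj₁ cd∈E)))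
    ... | no _     | yes refl = inj₂ (inj₁ (leaf c (inj₂ cd∈E) , refl))
    ... | no c≢b   | no d≢b   = inj₁ (∈-filter⁺ (avoids? b) cd∈E (c≢b , d≢b))

    Adj-split : ∀ {u v} → Adj E u v → Adj rest u v ⊎ IsNewEdge u v
    Adj-split (inj₁ uv∈E) = Sum.map inj₁ id (∈-split uv∈E)
    Adj-split (inj₂ vu∈E) = Sum.map inj₂ IsNewEdge-sym (∈-split vu∈E)

    ℓ′-old : ∀ {u v} → Adj rest u v → ℓ′ u v ≡ 2 + 2 * ℓ u v
    ℓ′-old {u} {v} u~v with u ≟ b | v ≟ b | Adj-removeVertex {E = E} u~v
    ... | no _     | no _     | _          = refl
    ... | yes u≡b  | _        | (u≢b , _)  = contradiction u≡b u≢b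
    ... | no _     | yes v≡b  | (_ , v≢b)  = contradiction v≡b v≢b

    ℓ′-new : ∀ {u v} → IsNewEdge u v → ℓ′ u v ≡ 1 + 2 * M
    ℓ′-new {u} {v} new with u ≟ b | v ≟ b | new
    ... | yes _ | _     | _                  = refl
    ... | no _  | yes _ | _                  = refl
    ... | no _  | no v≢b | inj₁ (_ , v≡b)    = contradiction v≡b v≢b
    ... | no u≢b | no _  | inj₂ (u≡b , _)    = contradiction u≡b u≢b

    ℓ′-sym : ∀ u v → ℓ′ u v ≡ ℓ′ v u
    ℓ′-sym u v with u ≟ b | v ≟ b
    ... | no _  | no _  = cong (λ k → 2 + 2 * k) (ℓ-sym u v)
    ... | yes _ | yes _ = refl
    ... | yes _ | no _  = refl
    ... | no _  | yes _ = refl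

    ℓ′-injective : ∀ c d c′ d′ → (c , d) ∈ E → (c′ , d′) ∈ E → ℓ′ c d ≡ ℓ′ c′ d′ → (c , d) ≡ (c′ , d′)
    ℓ′-injective c d c′ d′ cd∈E c′d′∈E eq with ∈-split cd∈E | ∈-split c′d′∈E
    ... | inj₁ cd∈rest | inj₁ c′d′∈rest =
      ℓ-injective c d c′ d′ cd∈rest c′d′∈rest (2+2*-injective
        (trans (sym (ℓ′-old (inj₁ cd∈rest))) (trans eq (ℓ′-old (inj₁ c′d′∈rest)))))
    ... | inj₁ cd∈rest | inj₂ new =
      contradiction (trans (sym (ℓ′-old (inj₁ cd∈rest))) (trans eq (ℓ′-new new)))
                    (2+2*≢1+2* (ℓ c d) M)
    ... | inj₂ new | inj₁ c′d′∈rest =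
      contradiction (trans (sym (ℓ′-old (inj₁ c′d′∈rest))) (trans (sym eq) (ℓ′-new new)))
                    (2+2*≢1+2* (ℓ c′ d′) M)
    ... | inj₂ (inj₁ (refl , refl)) | inj₂ (inj₁ (refl , refl)) = refl
    ... | inj₂ (inj₂ (refl , refl)) | inj₂ (inj₂ (refl , refl)) = refl
    ... | inj₂ (inj₁ (refl , refl)) | inj₂ (inj₂ (refl , refl)) =
      ⊥-elim (<ᶠ-asym (ordered _ _ cd∈E) (ordered _ _ c′d′∈E))
    ... | inj₂ (inj₂ (refl , refl)) | inj₂ (inj₁ (refl , refl)) =
      ⊥-elim (<ᶠ-asym (ordered _ _ cd∈E) (ordered _ _ c′d′∈E))

    ℓ′-increasing : ∀ u v w → Adj E u v → Adj E u w → CwBefore u v w → ℓ′ u v < ℓ′ u w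
    ℓ′-increasing u v w u~v u~w v<w with Adj-split u~v | Adj-split u~w
    ... | inj₁ u~ᵣv | inj₁ u~ᵣw = begin-strict
      ℓ′ u v          ≡⟨ ℓ′-old u~ᵣv ⟩
      2 + 2 * ℓ u v   <⟨ +-monoʳ-< 2 (*-monoʳ-< 2 (ℓ-increasing u v w u~ᵣv u~ᵣw v<w)) ⟩
      2 + 2 * ℓ u w   ≡⟨ ℓ′-old u~ᵣw ⟨
      ℓ′ u w          ∎
      where open ≤-Reasoning
    ... | inj₁ u~ᵣv | inj₂ new
      with IsNewEdge-avoiding (proj₁ (Adj-removeVertex {E = E} u~ᵣv)) new
    ...   | refl , refl = begin-strict
      ℓ′ a v          ≡⟨ ℓ′-old u~ᵣv ⟩
      2 + 2 * ℓ a v   <⟨ 2+2*<1+2* (before<M v u~ᵣv v<w) ⟩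
      1 + 2 * M       ≡⟨ ℓ′-new new ⟨
      ℓ′ a b          ∎
      where open ≤-Reasoning
    ℓ′-increasing u v w u~v u~w v<w | inj₂ new | inj₁ u~ᵣw
      with IsNewEdge-avoiding (proj₁ (Adj-removeVertex {E = E} u~ᵣw)) new
    ...   | refl , refl = begin-strict
      ℓ′ a b          ≡⟨ ℓ′-new new ⟩
      1 + 2 * M       <⟨ 1+2*<2+2* (M≤after w u~ᵣw v<w) ⟩
      2 + 2 * ℓ a w   ≡⟨ ℓ′-old u~ᵣw ⟨
      ℓ′ a w          ∎
      where open ≤-Reasoning
    ℓ′-increasing u v w u~v u~w v<w | inj₂ new | inj₂ new′ =
      contradiction (subst (CwBefore u v) (sym (IsNewEdge-functional new new′)) v<w) CwBefore-irrefl

    goodNumbering : GoodNumbering E ℓ′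
    goodNumbering = ℓ′-sym , ℓ′-injective , ℓ′-increasing

  acyclic⇒goodNumbering : ∀ (E : Edges m) → OrderedEdges E → ¬ HasCycle E → ∃ (GoodNumbering E)
  acyclic⇒goodNumbering E = go E (<-wellFounded (length E))
    where
    go : ∀ E → Acc _<_ (length E) → OrderedEdges E → ¬ HasCycle E → ∃ (GoodNumbering E)
    go [] _ _ _ =
      (λ _ _ → 0) , (λ _ _ → refl) , (λ _ _ _ _ ()) , λ { _ _ _ (inj₁ ()) _ _ ; _ _ _ (inj₂ ()) _ _ }
    go E@(_ ∷ _) (acc smaller) ordered acyclic
      with a , b , a~b , leaf ← acyclic⇒pendantEdge ordered acyclic (here refl) =
      let rest⊆E = removeVertex-⊆ b E
          _ , good = go (removeVertex b E) (smaller (length-removeVertex< a~b))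
                        (λ c d cd∈rest → ordered c d (rest⊆E cd∈rest))
                        (acyclic ∘ HasCycle-mono rest⊆E)
      in _ , PendantEdgeExtension.goodNumbering ordered a~b leaf good

lemma4p8 : (m : ℕ) (E : Edges m) → IsTree E → Noncrossing E →
    ∃ λ (ℓ : Fin m → Fin m → ℕ) → GoodNumbering E ℓ
lemma4p8 m E ((ordered , _) , _ , acyclic) _ = acyclic⇒goodNumbering E ordered acyclic
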